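{- For every finite $\sigma$-structure $\mathcal{G}$ and every $\ell\in\mathbb{N}$, $\mathcal{G}$ has an $\ell$-core $\mathcal{H}$ with at most $2^{2n+4m+2}\cdot\ell$ elements.
   Context: $\sigma$ consists of $n$ unary predicates $U_1,\dots,U_n$ and $m$ binary predicates $R_1,\dots,R_m$. The 1-type $\mathrm{OneTp}(v)$ of an element is the set of literals among $\{U_i(x),\neg U_i(x)\}_{i\le n}\cup\{R_i(x,x),\neg R_i(x,x)\}_{i\le m}$ it satisfies; the 2-type $\mathrm{TwoTp}(v,u)$ of a pair of distinct elements is the set of literals among $\{R_i(x,y),\neg R_i(x,y),R_i(y,x),\neg R_i(y,x)\}_{i\le m}$ it satisfies (with $x\mapsto v,y\mapsto u$). For a substructure $\mathcal{H}\subseteq\mathcal{G}$ (induced on a subset of elements), $\mathcal{G}\setminus\mathcal{H}$ denotes the elements of $\mathcal{G}$ not in $\mathcal{H}$. $\mathcal{H}$ is an $\ell$-core of $\mathcal{G}$ if (i) for every 1-type $\pi$, the number of elements of $\mathcal{G}\setminus\mathcal{H}$ with 1-type $\pi$ is either $0$ or at least $\ell$; and (ii) for all 1-types $\pi_1,\pi_2$ and every 2-type $\eta$, the number of pairs $(v,u)$ of elements of $\mathcal{G}\setminus\mathcal{H}$ with $v\neq u$, $\mathrm{OneTp}(v)=\pi_1$, $\mathrm{TwoTp}(v,u)=\eta$, $\mathrm{OneTp}(u)=\pi_2$ is either $0$ or at least $\ell$. -}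

module Defs where

open import Data.Nat using (ℕ; _≤_; _+_; _*_; _^_)
open import Data.Bool using (Bool; true; false; not; _∧_; T)
import Data.Bool.Properties as BoolP
open import Data.Fin using (Fin)
import Data.Fin.Properties as FinP
open import Data.Vec using (Vec; tabulate)
import Data.Vec.Properties as VecP
open import Data.List using (List; length; filter; allFin; cartesianProduct)
open import Data.Product using (_×_; _,_; proj₁; proj₂; Σ)
import Data.Product.Properties as ProdP
open import Data.Sum using (_⊎_)
open import Relation.Binary.PropositionalEquality using (_≡_)
open import Relation.Nullary using (¬_; Dec)
open import Relation.Nullary.Decidable using (_×-dec_; ¬?)

record Struct (n m : ℕ) : Set where
  field
    size : ℕ
    U    : Fin n → Fin size → Bool
    R    : Fin m → Fin size → Fin size → Bool
open Struct public

-- 1-type: truth values of U_i(x) (i<n) and R_i(x,x) (i<m).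
OneType : ℕ → ℕ → Set
OneType n m = Vec Bool n × Vec Bool m

-- 2-type of (x,y), x ≠ y: truth values of R_i(x,y) and R_i(y,x) (i<m).
TwoType : ℕ → Set
TwoType m = Vec Bool m × Vec Bool m

OneTp : ∀ {n m} (G : Struct n m) → Fin (size G) → OneType n m
OneTp G v = tabulate (λ i → U G i v) , tabulate (λ i → R G i v v)

TwoTp : ∀ {n m} (G : Struct n m) → Fin (size G) → Fin (size G) → TwoType m
TwoTp G v u = tabulate (λ i → R G i v u) , tabulate (λ i → R G i u v)

_≟1_ : ∀ {n m} (a b : OneType n m) → Dec (a ≡ b)
_≟1_ = ProdP.≡-dec (VecP.≡-dec BoolP._≟_) (VecP.≡-dec BoolP._≟_)

_≟2_ : ∀ {m} (a b : TwoType m) → Dec (a ≡ b)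
_≟2_ = ProdP.≡-dec (VecP.≡-dec BoolP._≟_) (VecP.≡-dec BoolP._≟_)

-- A substructure (induced on a subset of elements) is given by its
-- membership predicate on the universe of G.
Sub : ∀ {n m} → Struct n m → Set
Sub G = Fin (size G) → Bool

card : ∀ {n m} (G : Struct n m) → Sub G → ℕ
card G H = length (filter (λ v → H v BoolP.≟ true) (allFin (size G)))

count1 : ∀ {n m} (G : Struct n m) → Sub G → OneType n m → ℕ
count1 G H π =
  length (filter (λ v → (H v BoolP.≟ false) ×-dec (OneTp G v ≟1 π))
                 (allFin (size G)))

count2 : ∀ {n m} (G : Struct n m) → Sub G →
         OneType n m → TwoType m → OneType n m → ℕ
count2 G H π₁ η π₂ =
  length (filter
    (λ p → (H (proj₁ p) BoolP.≟ false) ×-dec ((H (proj₂ p) BoolP.≟ false)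
       ×-dec (¬? (proj₁ p FinP.≟ proj₂ p)
       ×-dec ((OneTp G (proj₁ p) ≟1 π₁)
       ×-dec ((TwoTp G (proj₁ p) (proj₂ p) ≟2 η)
       ×-dec (OneTp G (proj₂ p) ≟1 π₂))))))
    (cartesianProduct (allFin (size G)) (allFin (size G))))

IsCore : ∀ {n m} (ℓ : ℕ) (G : Struct n m) → Sub G → Set
IsCore ℓ G H =
  (∀ π → count1 G H π ≡ 0 ⊎ ℓ ≤ count1 G H π) ×
  (∀ π₁ η π₂ → count2 G H π₁ η π₂ ≡ 0 ⊎ ℓ ≤ count2 G H π₁ η π₂)

{-# OPTIONS --safe #-}
module Submission where

-- Grow H greedily from ∅. Call a 1-type π, or a triple (π₁, η, π₂), live if it is
-- realised outside H. If some live one is realised fewer than ℓ times, add to H the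
-- elements realising it (for a triple, the first coordinates of the realising pairs):
-- this adds fewer than ℓ elements and kills it. Counts only drop as H grows, so a dead
-- one stays dead; hence there are at most 2^(n+m) + 2^(2n+4m) ≤ 2^(2n+4m+2) rounds,
-- each adding fewer than ℓ elements.

open import Defs
open import Data.Nat using (ℕ; suc; _≤_; _<_; _+_; _*_; _^_; z≤n; s≤s; _≤?_)
open import Data.Nat.Properties
open import Data.Nat.Solver using (module +-*-Solver)
open import Data.Bool using (Bool; true; false; _∨_)
open import Data.Bool.Properties using (∨-conicalˡ; ∨-conicalʳ) renaming (_≟_ to _≟ᵇ_)
open import Data.Fin using (Fin) renaming (_≟_ to _≟ᶠ_)
open import Data.Vec using (Vec; []; _∷_)
open import Data.List
  using (List; []; _∷_; [_]; length; filter; allFin; map; _++_; cartesianProduct; cartesianProductWith)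
open import Data.List.Properties
  using (length-++; length-map; length-filter; filter-++; filter-none; filter-some)
open import Data.List.Membership.Propositional using (_∈_; find; lose)
open import Data.List.Membership.Propositional.Properties
  using (∈-map⁺; ∈-++⁺ˡ; ∈-++⁺ʳ; ∈-cartesianProduct⁺; ∈-cartesianProductWith⁺; ∈-allFin)
open import Data.List.Relation.Unary.Any using (Any; here; there; any?)
import Data.List.Relation.Unary.Any.Properties as Any
import Data.List.Relation.Unary.All as All
open import Data.List.Relation.Unary.All.Properties using (¬All⇒Any¬)
open import Data.Product using (Σ; _×_; _,_)
open import Data.Sum using (_⊎_; inj₁; inj₂)
open import Function using (_∘_)
open import Level using (0ℓ)
open import Relation.Nullary using (¬_; Dec; yes; no; does; contradiction)
open import Relation.Nullary.Decidable using (_×-dec_; ¬?; _⊎-dec_; dec-true)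
open import Relation.Unary using (Pred; Decidable)
open import Relation.Binary.PropositionalEquality
  using (_≡_; _≢_; refl; sym; trans; cong; cong₂; subst; module ≡-Reasoning)

module _ {A : Set} where

  length-filter-does : {P : Pred A 0ℓ} (P? : Decidable P) (xs : List A) →
    length (filter (λ x → does (P? x) ≟ᵇ true) xs) ≡ length (filter P? xs)
  length-filter-does P? [] = refl
  length-filter-does P? (x ∷ xs) with P? x
  ... | yes _ = cong suc (length-filter-does P? xs)
  ... | no _  = length-filter-does P? xs

  length-filter-++ : {P : Pred A 0ℓ} (P? : Decidable P) (xs ys : List A) →
    length (filter P? (xs ++ ys)) ≡ length (filter P? xs) + length (filter P? ys)
  length-filter-++ P? xs ys = trans (cong length (filter-++ P? xs ys)) (length-++ (filter P? xs))

  length-filter-∨ : (b c : A → Bool) (xs : List A) →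
    length (filter (λ x → b x ∨ c x ≟ᵇ true) xs) ≤
    length (filter (λ x → b x ≟ᵇ true) xs) + length (filter (λ x → c x ≟ᵇ true) xs)
  length-filter-∨ b c [] = z≤n
  length-filter-∨ b c (x ∷ xs) with b x | c x | length-filter-∨ b c xs
  ... | true  | true  | ih = s≤s (≤-trans ih (+-monoʳ-≤ _ (n≤1+n _)))
  ... | true  | false | ih = s≤s ih
  ... | false | true  | ih = ≤-trans (s≤s ih) (≤-reflexive (sym (+-suc _ _)))
  ... | false | false | ih = ih

module _ {A : Set} {P Q : Pred A 0ℓ} (P? : Decidable P) (Q? : Decidable Q)
         (P⊆Q : ∀ {x} → P x → Q x) where

  length-filter-mono : (xs : List A) → length (filter P? xs) ≤ length (filter Q? xs)
  length-filter-mono [] = z≤n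
  length-filter-mono (x ∷ xs) with P? x | Q? x
  ... | yes _  | yes _  = s≤s (length-filter-mono xs)
  ... | yes px | no ¬qx = contradiction (P⊆Q px) ¬qx
  ... | no _   | yes _  = m≤n⇒m≤1+n (length-filter-mono xs)
  ... | no _   | no _   = length-filter-mono xs

  length-filter-mono-< : ∀ {x xs} → x ∈ xs → Q x → ¬ P x →
    length (filter P? xs) < length (filter Q? xs)
  length-filter-mono-< {x} {_ ∷ xs} (here refl) qx ¬px with P? x | Q? x
  ... | yes px | _      = contradiction px ¬px
  ... | no _   | yes _  = s≤s (length-filter-mono xs)
  ... | no _   | no ¬qx = contradiction qx ¬qx
  length-filter-mono-< {_} {y ∷ xs} (there x∈xs) qx ¬px
    with P? y | Q? y | length-filter-mono-< x∈xs qx ¬px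
  ... | yes _  | yes _  | ih = s≤s ih
  ... | yes py | no ¬qy | _  = contradiction (P⊆Q py) ¬qy
  ... | no _   | yes _  | ih = m<n⇒m<1+n ih
  ... | no _   | no _   | ih = ih

module _ {A B : Set} where

  length-cartesianProductWith : {C : Set} (f : A → B → C) (xs : List A) (ys : List B) →
    length (cartesianProductWith f xs ys) ≡ length xs * length ys
  length-cartesianProductWith f [] ys = refl
  length-cartesianProductWith f (x ∷ xs) ys =
    trans (length-++ (map (f x) ys))
          (cong₂ _+_ (length-map (f x) ys) (length-cartesianProductWith f xs ys))

  length-filter-partnered : {Q : Pred (A × B) 0ℓ} (Q? : Decidable Q) (xs : List A) (ys : List B) →
    length (filter (λ x → any? (λ y → Q? (x , y)) ys) xs) ≤
    length (filter Q? (cartesianProduct xs ys))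
  length-filter-partnered Q? [] ys = z≤n
  length-filter-partnered Q? (x ∷ xs) ys
    with any? (λ y → Q? (x , y)) ys | length-filter-partnered Q? xs ys
  ... | yes partner | ih = subst (_ ≤_) (sym (length-filter-++ Q? (map (x ,_) ys) _))
                             (+-mono-≤ (filter-some Q? (Any.map⁺ partner)) ih)
  ... | no _        | ih = subst (_ ≤_) (sym (length-filter-++ Q? (map (x ,_) ys) _))
                             (≤-trans ih (m≤n+m _ _))

allVecs : (k : ℕ) → List (Vec Bool k)
allVecs 0       = [ [] ]
allVecs (suc k) = cartesianProductWith _∷_ (true ∷ false ∷ []) (allVecs k)

length-allVecs : (k : ℕ) → length (allVecs k) ≡ 2 ^ k
length-allVecs 0       = refl
length-allVecs (suc k) =
  trans (length-cartesianProductWith _∷_ (true ∷ false ∷ []) (allVecs k))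
        (cong (2 *_) (length-allVecs k))

∈-allVecs : ∀ {k} (v : Vec Bool k) → v ∈ allVecs k
∈-allVecs []      = here refl
∈-allVecs (b ∷ v) = ∈-cartesianProductWith⁺ _∷_ (∈-bools b) (∈-allVecs v)
  where
  ∈-bools : (b : Bool) → b ∈ true ∷ false ∷ []
  ∈-bools true  = here refl
  ∈-bools false = there (here refl)

ZeroOrAtLeast : ℕ → ℕ → Set
ZeroOrAtLeast ℓ k = k ≡ 0 ⊎ ℓ ≤ k

zeroOrAtLeast? : (ℓ k : ℕ) → Dec (ZeroOrAtLeast ℓ k)
zeroOrAtLeast? ℓ k = (k ≟ 0) ⊎-dec (ℓ ≤? k)

module Greedy {S C : Set} (_⊑_ : S → S → Set) (size : S → ℕ) (count : C → S → ℕ)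
  (count-antitone : ∀ c {H H'} → H ⊑ H' → count c H' ≤ count c H)
  (clear : ∀ c H → Σ S λ H' → H ⊑ H' × size H' ≤ size H + count c H × count c H' ≡ 0)
  (ℓ : ℕ) (cs : List C) where

  live : S → ℕ
  live H = length (filter (λ c → ¬? (count c H ≟ 0)) cs)

  live-decreases : ∀ {c H H'} → H ⊑ H' → c ∈ cs → count c H ≢ 0 → count c H' ≡ 0 →
    live H' < live H
  live-decreases {c} {H} {H'} H⊑H' c∈cs alive dead =
    length-filter-mono-< (λ d → ¬? (count d H' ≟ 0)) (λ d → ¬? (count d H ≟ 0))
      stays-alive c∈cs alive (λ alive' → alive' dead)
    where
    stays-alive : ∀ {d} → count d H' ≢ 0 → count d H ≢ 0
    stays-alive {d} alive' empty =
      alive' (n≤0⇒n≡0 (subst (count d H' ≤_) empty (count-antitone d H⊑H')))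

  budget-step : ∀ {s s' k l l' b} → s' ≤ s + k → k ≤ ℓ → l' < l →
    s + l * ℓ ≤ b → s' + l' * ℓ ≤ b
  budget-step {s} {s'} {k} {l} {l'} {b} grows k≤ℓ l'<l within = begin
    s' + l' * ℓ      ≤⟨ +-monoˡ-≤ (l' * ℓ) grows ⟩
    s + k + l' * ℓ   ≤⟨ +-monoˡ-≤ (l' * ℓ) (+-monoʳ-≤ s k≤ℓ) ⟩
    s + ℓ + l' * ℓ   ≡⟨ +-assoc s ℓ (l' * ℓ) ⟩
    s + suc l' * ℓ   ≤⟨ +-monoʳ-≤ s (*-monoˡ-≤ ℓ l'<l) ⟩
    s + l * ℓ        ≤⟨ within ⟩
    b                ∎
    where open ≤-Reasoning

  Settled : S → Set
  Settled H = ∀ {c} → c ∈ cs → ZeroOrAtLeast ℓ (count c H)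

  settle-within : (k : ℕ) (H : S) {b : ℕ} → live H < k → size H + live H * ℓ ≤ b →
    Σ S λ H' → Settled H' × size H' ≤ b
  settle-within 0       H ()     within
  settle-within (suc k) H live<k within with All.all? (λ c → zeroOrAtLeast? ℓ (count c H)) cs
  ... | yes settled = H , All.lookup settled , ≤-trans (m≤m+n _ _) within
  ... | no unsettled with find (¬All⇒Any¬ (λ c → zeroOrAtLeast? ℓ (count c H)) cs unsettled)
  ...   | c , c∈cs , bad with clear c H
  ...     | H' , H⊑H' , grows , dead =
    settle-within k H' (<-≤-trans shrinks (≤-pred live<k))
      (budget-step grows (<⇒≤ (≰⇒> (bad ∘ inj₂))) shrinks within)
    where
    shrinks : live H' < live H
    shrinks = live-decreases H⊑H' c∈cs (bad ∘ inj₁) dead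

  settled-extension : (H₀ : S) → Σ S λ H → Settled H × size H ≤ size H₀ + length cs * ℓ
  settled-extension H₀ = settle-within (suc (live H₀)) H₀ ≤-refl
    (+-monoʳ-≤ (size H₀) (*-monoˡ-≤ ℓ (length-filter _ cs)))

Constraint : ℕ → ℕ → Set
Constraint n m = OneType n m ⊎ OneType n m × TwoType m × OneType n m

module _ {n m : ℕ} (G : Struct n m) where

  elements : List (Fin (size G))
  elements = allFin (size G)

  _∪_ : Sub G → Sub G → Sub G
  (H ∪ K) v = H v ∨ K v

  _⊆_ : Sub G → Sub G → Set
  H ⊆ H' = ∀ v → H' v ≡ false → H v ≡ false

  ⊆-∪ˡ : ∀ H K → H ⊆ (H ∪ K)
  ⊆-∪ˡ H K v = ∨-conicalˡ (H v) (K v)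

  ∪-excludesʳ : ∀ H K v → K v ≡ true → (H ∪ K) v ≢ false
  ∪-excludesʳ H K v covered out with trans (sym covered) (∨-conicalʳ (H v) (K v) out)
  ... | ()

  card-∪ : ∀ H K → card G (H ∪ K) ≤ card G H + card G K
  card-∪ H K = length-filter-∨ H K elements

  card-∅ : card G (λ _ → false) ≡ 0
  card-∅ = cong length (filter-none (λ v → false ≟ᵇ true) (All.universal (λ _ ()) elements))

  Witness1 : Sub G → OneType n m → Pred (Fin (size G)) 0ℓ
  Witness1 H π v = H v ≡ false × OneTp G v ≡ π

  -- witness1? and witness2? are verbatim the tests inside count1 and count2, so that
  -- those counts unfold definitionally to filters by them.
  witness1? : ∀ H π → Decidable (Witness1 H π)
  witness1? H π v = (H v ≟ᵇ false) ×-dec (OneTp G v ≟1 π)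

  Witness2 : Sub G → OneType n m → TwoType m → OneType n m → Pred (Fin (size G) × Fin (size G)) 0ℓ
  Witness2 H π₁ η π₂ (v , u) =
    H v ≡ false × H u ≡ false × v ≢ u × OneTp G v ≡ π₁ × TwoTp G v u ≡ η × OneTp G u ≡ π₂

  witness2? : ∀ H π₁ η π₂ → Decidable (Witness2 H π₁ η π₂)
  witness2? H π₁ η π₂ (v , u) =
    (H v ≟ᵇ false) ×-dec (H u ≟ᵇ false) ×-dec ¬? (v ≟ᶠ u) ×-dec
    (OneTp G v ≟1 π₁) ×-dec (TwoTp G v u ≟2 η) ×-dec (OneTp G u ≟1 π₂)

  witness1-antitone : ∀ {H H' π v} → H ⊆ H' → Witness1 H' π v → Witness1 H π v
  witness1-antitone {v = v} H⊆H' (out , tp) = H⊆H' v out , tp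

  witness2-antitone : ∀ {H H' π₁ η π₂ p} → H ⊆ H' → Witness2 H' π₁ η π₂ p → Witness2 H π₁ η π₂ p
  witness2-antitone {p = v , u} H⊆H' (out₁ , out₂ , rest) = H⊆H' v out₁ , H⊆H' u out₂ , rest

  count1-antitone : ∀ {H H'} π → H ⊆ H' → count1 G H' π ≤ count1 G H π
  count1-antitone {H} {H'} π H⊆H' =
    length-filter-mono (witness1? H' π) (witness1? H π) (witness1-antitone H⊆H') elements

  count2-antitone : ∀ {H H'} π₁ η π₂ → H ⊆ H' → count2 G H' π₁ η π₂ ≤ count2 G H π₁ η π₂
  count2-antitone {H} {H'} π₁ η π₂ H⊆H' =
    length-filter-mono (witness2? H' π₁ η π₂) (witness2? H π₁ η π₂) (witness2-antitone H⊆H')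
      (cartesianProduct elements elements)

  clear1 : ∀ H π → Σ (Sub G) λ H' →
    H ⊆ H' × card G H' ≤ card G H + count1 G H π × count1 G H' π ≡ 0
  clear1 H π = H ∪ K , ⊆-∪ˡ H K , grows , cleared
    where
    K : Sub G
    K v = does (witness1? H π v)
    grows : card G (H ∪ K) ≤ card G H + count1 G H π
    grows = subst (card G (H ∪ K) ≤_)
              (cong (card G H +_) (length-filter-does (witness1? H π) elements)) (card-∪ H K)
    gone : ∀ v → ¬ Witness1 (H ∪ K) π v
    gone v t@(out , _) =
      ∪-excludesʳ H K v (dec-true (witness1? H π v) (witness1-antitone (⊆-∪ˡ H K) t)) out
    cleared : count1 G (H ∪ K) π ≡ 0
    cleared = cong length (filter-none (witness1? (H ∪ K) π) (All.universal gone elements))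

  clear2 : ∀ H π₁ η π₂ → Σ (Sub G) λ H' →
    H ⊆ H' × card G H' ≤ card G H + count2 G H π₁ η π₂ × count2 G H' π₁ η π₂ ≡ 0
  clear2 H π₁ η π₂ = H ∪ K , ⊆-∪ˡ H K , grows , cleared
    where
    partnered? : Decidable λ v → Any (λ u → Witness2 H π₁ η π₂ (v , u)) elements
    partnered? v = any? (λ u → witness2? H π₁ η π₂ (v , u)) elements
    K : Sub G
    K v = does (partnered? v)
    grows : card G (H ∪ K) ≤ card G H + count2 G H π₁ η π₂
    grows = ≤-trans (card-∪ H K) (+-monoʳ-≤ (card G H) (≤-trans
              (≤-reflexive (length-filter-does partnered? elements))
              (length-filter-partnered (witness2? H π₁ η π₂) elements elements)))
    gone : ∀ p → ¬ Witness2 (H ∪ K) π₁ η π₂ p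
    gone (v , u) t@(out , _) = ∪-excludesʳ H K v
      (dec-true (partnered? v) (lose (∈-allFin u) (witness2-antitone (⊆-∪ˡ H K) t))) out
    cleared : count2 G (H ∪ K) π₁ η π₂ ≡ 0
    cleared = cong length (filter-none (witness2? (H ∪ K) π₁ η π₂)
                (All.universal gone (cartesianProduct elements elements)))

  count : Constraint n m → Sub G → ℕ
  count (inj₁ π)            H = count1 G H π
  count (inj₂ (π₁ , η , π₂)) H = count2 G H π₁ η π₂

  count-antitone : ∀ c {H H'} → H ⊆ H' → count c H' ≤ count c H
  count-antitone (inj₁ π)            = count1-antitone π
  count-antitone (inj₂ (π₁ , η , π₂)) = count2-antitone π₁ η π₂

  clear : ∀ c H → Σ (Sub G) λ H' → H ⊆ H' × card G H' ≤ card G H + count c H × count c H' ≡ 0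
  clear (inj₁ π)            H = clear1 H π
  clear (inj₂ (π₁ , η , π₂)) H = clear2 H π₁ η π₂

allVecPairs : (k l : ℕ) → List (Vec Bool k × Vec Bool l)
allVecPairs k l = cartesianProduct (allVecs k) (allVecs l)

∈-allVecPairs : ∀ {k l} (p : Vec Bool k × Vec Bool l) → p ∈ allVecPairs k l
∈-allVecPairs (u , v) = ∈-cartesianProduct⁺ (∈-allVecs u) (∈-allVecs v)

length-allVecPairs : ∀ k l → length (allVecPairs k l) ≡ 2 ^ (k + l)
length-allVecPairs k l = begin
  length (cartesianProduct (allVecs k) (allVecs l))  ≡⟨ length-cartesianProductWith _,_ (allVecs k) (allVecs l) ⟩
  length (allVecs k) * length (allVecs l)            ≡⟨ cong₂ _*_ (length-allVecs k) (length-allVecs l) ⟩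
  2 ^ k * 2 ^ l                                      ≡⟨ ^-distribˡ-+-* 2 k l ⟨
  2 ^ (k + l)                                        ∎
  where open ≡-Reasoning

allTriples : (n m : ℕ) → List (OneType n m × TwoType m × OneType n m)
allTriples n m = cartesianProduct (allVecPairs n m) (cartesianProduct (allVecPairs m m) (allVecPairs n m))

length-allTriples : ∀ n m → length (allTriples n m) ≡ 2 ^ (2 * n + 4 * m)
length-allTriples n m = begin
  length (allTriples n m)
    ≡⟨ length-cartesianProductWith _,_ (allVecPairs n m) _ ⟩
  length (allVecPairs n m) * length (cartesianProduct (allVecPairs m m) (allVecPairs n m))
    ≡⟨ cong (length (allVecPairs n m) *_) (length-cartesianProductWith _,_ (allVecPairs m m) _) ⟩
  length (allVecPairs n m) * (length (allVecPairs m m) * length (allVecPairs n m))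
    ≡⟨ cong₂ (λ a b → a * (b * a)) (length-allVecPairs n m) (length-allVecPairs m m) ⟩
  2 ^ (n + m) * (2 ^ (m + m) * 2 ^ (n + m))
    ≡⟨ cong (2 ^ (n + m) *_) (^-distribˡ-+-* 2 (m + m) (n + m)) ⟨
  2 ^ (n + m) * 2 ^ ((m + m) + (n + m))
    ≡⟨ ^-distribˡ-+-* 2 (n + m) ((m + m) + (n + m)) ⟨
  2 ^ ((n + m) + ((m + m) + (n + m)))
    ≡⟨ cong (2 ^_) (solve 2 (λ n m → (n :+ m) :+ ((m :+ m) :+ (n :+ m)) := con 2 :* n :+ con 4 :* m) refl n m) ⟩
  2 ^ (2 * n + 4 * m) ∎
  where
  open ≡-Reasoning
  open +-*-Solver

allConstraints : (n m : ℕ) → List (Constraint n m)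
allConstraints n m = map inj₁ (allVecPairs n m) ++ map inj₂ (allTriples n m)

∈-allConstraints : ∀ {n m} (c : Constraint n m) → c ∈ allConstraints n m
∈-allConstraints (inj₁ π) = ∈-++⁺ˡ (∈-map⁺ inj₁ (∈-allVecPairs π))
∈-allConstraints (inj₂ (π₁ , η , π₂)) = ∈-++⁺ʳ _ (∈-map⁺ inj₂
  (∈-cartesianProduct⁺ (∈-allVecPairs π₁) (∈-cartesianProduct⁺ (∈-allVecPairs η) (∈-allVecPairs π₂))))

length-allConstraints : ∀ n m → length (allConstraints n m) ≡ 2 ^ (n + m) + 2 ^ (2 * n + 4 * m)
length-allConstraints n m =
  trans (length-++ (map inj₁ (allVecPairs n m)))
        (cong₂ _+_ (trans (length-map inj₁ (allVecPairs n m)) (length-allVecPairs n m))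
                   (trans (length-map inj₂ (allTriples n m)) (length-allTriples n m)))

2^m+2^n≤2^[n+2] : ∀ {m n} → m ≤ n → 2 ^ m + 2 ^ n ≤ 2 ^ (n + 2)
2^m+2^n≤2^[n+2] {m} {n} m≤n = begin
  2 ^ m + 2 ^ n  ≤⟨ +-monoˡ-≤ (2 ^ n) (^-monoʳ-≤ 2 m≤n) ⟩
  2 ^ n + 2 ^ n  ≡⟨ cong (2 ^ n +_) (+-identityʳ (2 ^ n)) ⟨
  2 ^ suc n      ≤⟨ ^-monoʳ-≤ 2 (≤-trans (n≤1+n (suc n)) (≤-reflexive (+-comm 2 n))) ⟩
  2 ^ (n + 2)    ∎
  where open ≤-Reasoning

lemma33 : ∀ {n m} (G : Struct n m) (ℓ : ℕ) →
    Σ (Sub G) (λ H → IsCore ℓ G H × card G H ≤ 2 ^ (2 * n + 4 * m + 2) * ℓ)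
lemma33 {n} {m} G ℓ =
  let H , settled , small = settled-extension (λ _ → false) in
  H , ((λ π → settled (∈-allConstraints (inj₁ π))) ,
       (λ π₁ η π₂ → settled (∈-allConstraints (inj₂ (π₁ , η , π₂))))) ,
  ≤-trans small bound
  where
  open Greedy (_⊆_ G) (card G) (count G) (count-antitone G) (clear G) ℓ (allConstraints n m)
  bound : card G (λ _ → false) + length (allConstraints n m) * ℓ ≤ 2 ^ (2 * n + 4 * m + 2) * ℓ
  bound = begin
    card G (λ _ → false) + length (allConstraints n m) * ℓ  ≡⟨ cong (_+ _) (card-∅ G) ⟩
    length (allConstraints n m) * ℓ                         ≡⟨ cong (_* ℓ) (length-allConstraints n m) ⟩
    (2 ^ (n + m) + 2 ^ (2 * n + 4 * m)) * ℓ                 ≤⟨ *-monoˡ-≤ ℓ (2^m+2^n≤2^[n+2] n+m≤2n+4m) ⟩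
    2 ^ (2 * n + 4 * m + 2) * ℓ                             ∎
    where
    open ≤-Reasoning
    n+m≤2n+4m : n + m ≤ 2 * n + 4 * m
    n+m≤2n+4m = +-mono-≤ (m≤m+n n _) (m≤m+n m _)
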